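{- Let $h\ge 1$ and $t_1,s_1,\dots,t_h,s_h$ be positive integers, and let $G$ be the threshold graph generated by $b=(0^{t_1}1^{s_1})(0^{t_2}1^{s_2})\cdots(0^{t_h}1^{s_h})$. Put $T=\sum_{i=1}^h t_i$, $S=\sum_{i=1}^h s_i$, $r=T-1$, $s=S+1$. Let $e_1\le e_2\le\cdots\le e_s$ be the degrees, listed in non-decreasing order, of the vertices of $J$ in the graph $B$ (notation in the context). Suppose $s>r$. Then $e_{s-r}=0$ if and only if either ($t_1\neq 1$ and $s-r=1$) or ($t_1=1$ and $s-r\in\{1,2,\dots,s_1+1\}$).
   Context: For a binary sequence $b=(b_1b_2\cdots b_n)$ the threshold graph $G(b)$ has vertex set $\{1,\dots,n\}$, and for $i<j$ the vertices $i,j$ are adjacent iff $b_j=1$ (vertex $j$ is added as an isolated vertex if $b_j=0$ and as a dominating vertex if $b_j=1$). Here $b_1=0$. Notation $0^{t}$ / $1^{s}$ denotes a run of $t$ zeros / $s$ ones. Let $V$ be the set of vertices $j$ with $b_j=1$, let $x$ be vertex $1$, let $J=V\cup\{x\}$ (a maximal clique of size $s=S+1$) and $I$ the set of remaining vertices (a co-clique of size $r=T-1$). $B$ is the bipartite graph obtained from $G$ by deleting all edges with both endpoints in $J$; the degree of a vertex of $J$ in $B$ is its number of neighbours in $I$. -}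

module Defs where

open import Data.Nat using (ℕ; zero; suc; _+_; _∸_; _<ᵇ_; _≡ᵇ_)
open import Data.Nat.Properties using (≤-decTotalOrder)
open import Data.Bool using (Bool; true; false; _∧_; _∨_; not; if_then_else_)
open import Data.List using (List; []; _∷_; _++_; replicate; length; map; upTo; concatMap)
open import Data.Product using (_×_; _,_; proj₁; proj₂)
open import Data.Maybe using (Maybe; just; nothing)
import Data.List.Sort

-- Binary sequence b = (0^{t_1} 1^{s_1}) ... (0^{t_h} 1^{s_h}) from the list of pairs (t_i , s_i).
-- false = 0, true = 1.
blockSeq : List (ℕ × ℕ) → List Bool
blockSeq = concatMap (λ p → replicate (proj₁ p) false ++ replicate (proj₂ p) true)

sumT : List (ℕ × ℕ) → ℕ
sumT []             = 0
sumT ((t , _) ∷ ps) = t + sumT ps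

sumS : List (ℕ × ℕ) → ℕ
sumS []             = 0
sumS ((_ , s) ∷ ps) = s + sumS ps

-- Vertices are 0-indexed: index k is vertex k+1 of the paper; vertex x = 1 is index 0.
-- bit b k = b_{k+1} (false outside the range, never used there).
bit : List Bool → ℕ → Bool
bit []       _       = false
bit (c ∷ cs) zero    = c
bit (c ∷ cs) (suc k) = bit cs k

adj : List Bool → ℕ → ℕ → Bool
adj b i j = if i <ᵇ j then bit b j else (if j <ᵇ i then bit b i else false)

-- J = V ∪ {x}: vertices with b = 1, together with vertex 1 (index 0).
inJ : List Bool → ℕ → Bool
inJ b v = bit b v ∨ (v ≡ᵇ 0)

inI : List Bool → ℕ → Bool
inI b v = not (inJ b v)

filterB : (ℕ → Bool) → List ℕ → List ℕ
filterB p []       = []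
filterB p (x ∷ xs) = if p x then x ∷ filterB p xs else filterB p xs

vertices : List Bool → List ℕ
vertices b = upTo (length b)

Jverts : List Bool → List ℕ
Jverts b = filterB (inJ b) (vertices b)

degB : List Bool → ℕ → ℕ
degB b v = length (filterB (λ u → inI b u ∧ adj b u v) (vertices b))

open Data.List.Sort ≤-decTotalOrder using (sort)

sortedDegs : List Bool → List ℕ
sortedDegs b = sort (map (degB b) (Jverts b))

-- k-th entry (1-based) of a list, nothing if out of range
nth1 : List ℕ → ℕ → Maybe ℕ
nth1 []       _             = nothing
nth1 (x ∷ xs) zero          = nothing
nth1 (x ∷ xs) (suc zero)    = just x
nth1 (x ∷ xs) (suc (suc k)) = nth1 xs (suc k)

e : List Bool → ℕ → Maybe ℕ
e b k = nth1 (sortedDegs b) k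

-- A vertex of J has degree 0 in B iff no vertex of I precedes it, i.e. iff it is x or every
-- vertex from 2 up to it carries a 1.  So the vertices of J of degree 0 are x together with
-- the initial run of ones of b₂b₃…, which is x alone when t₁ ≥ 2 and x plus the first s₁
-- ones when t₁ = 1.  Sorted degrees start with exactly that many zeros, and s − r ≥ 1.
module Submission where

open import Defs
open import Data.Nat using (ℕ; _+_; _∸_; _≤_; _<_)
open import Data.List using (List; _∷_)
open import Data.List.Relation.Unary.All using (All)
open import Data.Product using (_×_; _,_; proj₁; proj₂)
open import Data.Sum using (_⊎_)
open import Data.Maybe using (just)
open import Relation.Binary.PropositionalEquality using (_≡_; _≢_)
open import Function.Bundles using (_⇔_)

open import Data.List.Relation.Unary.All using (_∷_)
open import Data.Nat using (zero; suc; z≤n; s≤s; _⊓_; _<ᵇ_; _≡ᵇ_)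
open import Data.Nat.Properties
open import Data.Bool using (Bool; true; false; T; _∧_)
open import Data.Bool.Properties using (∧-zeroʳ; ∨-zeroʳ; ∨-identityʳ)
open import Data.List using ([]; _++_; [_]; replicate; length; map; upTo)
open import Data.List.Properties using (upTo-∷ʳ)
open import Data.List.Membership.Propositional using (_∈_)
open import Data.List.Membership.Propositional.Properties using (∈-upTo⁺)
open import Data.List.Relation.Unary.Any using (here; there)
open import Data.List.Relation.Unary.Linked using (Linked; [-]; _∷_; tail)
open import Data.List.Relation.Binary.Permutation.Propositional as ↭ using (_↭_)
open import Data.Sum using (inj₁; inj₂)
open import Data.Empty using (⊥-elim)
open import Function.Bundles using (mk⇔; Equivalence)
open import Relation.Nullary using (Dec; yes; no)
open import Relation.Binary.PropositionalEquality
  using (refl; sym; trans; cong; cong₂; subst; module ≡-Reasoning)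
import Data.List.Sort
open Data.List.Sort ≤-decTotalOrder using (sort; sort-↭; sort-↗)

<ᵇ-true : ∀ {m n} → m < n → (m <ᵇ n) ≡ true
<ᵇ-true {zero}  (s≤s _)   = refl
<ᵇ-true {suc m} (s≤s m<n) = <ᵇ-true m<n

<ᵇ-false : ∀ {m n} → n ≤ m → (m <ᵇ n) ≡ false
<ᵇ-false z≤n       = refl
<ᵇ-false (s≤s n≤m) = <ᵇ-false n≤m

≡ᵇ0-false : ∀ {n} → 0 < n → (n ≡ᵇ 0) ≡ false
≡ᵇ0-false (s≤s _) = refl

countB : (ℕ → Bool) → List ℕ → ℕ
countB p xs = length (filterB p xs)

countB-++ : ∀ p xs ys → countB p (xs ++ ys) ≡ countB p xs + countB p ys
countB-++ p []       ys = refl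
countB-++ p (x ∷ xs) ys with p x
... | true  = cong suc (countB-++ p xs ys)
... | false = countB-++ p xs ys

countB-↭ : ∀ p {xs ys} → xs ↭ ys → countB p xs ≡ countB p ys
countB-↭ p ↭.refl = refl
countB-↭ p (↭.prep x xs↭ys) with p x
... | true  = cong suc (countB-↭ p xs↭ys)
... | false = countB-↭ p xs↭ys
countB-↭ p (↭.swap x y xs↭ys) with p x | p y
... | true  | true  = cong (λ n → suc (suc n)) (countB-↭ p xs↭ys)
... | true  | false = cong suc (countB-↭ p xs↭ys)
... | false | true  = cong suc (countB-↭ p xs↭ys)
... | false | false = countB-↭ p xs↭ys
countB-↭ p (↭.trans xs↭ys ys↭zs) = trans (countB-↭ p xs↭ys) (countB-↭ p ys↭zs)

countB-map-filterB : ∀ q (f : ℕ → ℕ) p xs →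
  countB q (map f (filterB p xs)) ≡ countB (λ x → p x ∧ q (f x)) xs
countB-map-filterB q f p []       = refl
countB-map-filterB q f p (x ∷ xs) with p x
... | false = countB-map-filterB q f p xs
... | true with q (f x)
...   | true  = cong suc (countB-map-filterB q f p xs)
...   | false = countB-map-filterB q f p xs

countB-none : ∀ p xs → (∀ x → p x ≡ false) → countB p xs ≡ 0
countB-none p []       _    = refl
countB-none p (x ∷ xs) none rewrite none x = countB-none p xs none

countB-∈ : ∀ p {x xs} → x ∈ xs → p x ≡ true → 0 < countB p xs
countB-∈ p {xs = y ∷ ys} (here refl) px rewrite px = s≤s z≤n
countB-∈ p {xs = y ∷ ys} (there x∈ys) px with p y
... | true  = s≤s z≤n
... | false = countB-∈ p x∈ys px

countB-upTo-initialSegment : ∀ p m n → (∀ v → v < n → p v ≡ (v <ᵇ m)) →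
  countB p (upTo n) ≡ n ⊓ m
countB-upTo-initialSegment p m zero    _ = refl
countB-upTo-initialSegment p m (suc n) p≗<m = begin
  countB p (upTo (suc n))            ≡⟨ cong (countB p) (sym (upTo-∷ʳ n)) ⟩
  countB p (upTo n ++ [ n ])         ≡⟨ countB-++ p (upTo n) [ n ] ⟩
  countB p (upTo n) + countB p [ n ] ≡⟨ cong₂ _+_ ih (cong (λ c → countB (λ _ → c) [ n ]) (p≗<m n ≤-refl)) ⟩
  n ⊓ m + countB (_<ᵇ m) [ n ]       ≡⟨ step (n <? m) ⟩
  suc n ⊓ m                          ∎
  where
  open ≡-Reasoning
  ih : countB p (upTo n) ≡ n ⊓ m
  ih = countB-upTo-initialSegment p m n (λ v v<n → p≗<m v (m<n⇒m<1+n v<n))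
  step : Dec (n < m) → n ⊓ m + countB (_<ᵇ m) [ n ] ≡ suc n ⊓ m
  step (yes n<m) rewrite <ᵇ-true n<m | m≤n⇒m⊓n≡m (<⇒≤ n<m) | m≤n⇒m⊓n≡m n<m = +-comm n 1
  step (no n≮m) rewrite <ᵇ-false (≮⇒≥ n≮m) | m≥n⇒m⊓n≡n (≮⇒≥ n≮m) | m≥n⇒m⊓n≡n (m≤n⇒m≤1+n (≮⇒≥ n≮m)) = +-identityʳ m

zeros : List ℕ → ℕ
zeros = countB (_≡ᵇ 0)

zeros-sorted-positive : ∀ {x xs} → Linked _≤_ (suc x ∷ xs) → zeros xs ≡ 0
zeros-sorted-positive [-]                            = refl
zeros-sorted-positive {xs = suc y ∷ ys} (_ ∷ sorted) = zeros-sorted-positive sorted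

nth1-sorted≡0⇒ : ∀ {xs} k → Linked _≤_ xs → nth1 xs k ≡ just 0 → 1 ≤ k × k ≤ zeros xs
nth1-sorted≡0⇒ {zero ∷ xs}  1 _ _ = s≤s z≤n , s≤s z≤n
nth1-sorted≡0⇒ {zero ∷ xs}  (suc (suc k)) sorted eq =
  s≤s z≤n , s≤s (proj₂ (nth1-sorted≡0⇒ (suc k) (tail sorted) eq))
nth1-sorted≡0⇒ {suc x ∷ xs} (suc (suc k)) sorted eq
  with () ← subst (suc k ≤_) (zeros-sorted-positive sorted)
                  (proj₂ (nth1-sorted≡0⇒ (suc k) (tail sorted) eq))

nth1-sorted≡0⇐ : ∀ {xs} k → Linked _≤_ xs → 1 ≤ k → k ≤ zeros xs → nth1 xs k ≡ just 0
nth1-sorted≡0⇐ {zero ∷ xs}  1             _      _ _         = refl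
nth1-sorted≡0⇐ {zero ∷ xs}  (suc (suc k)) sorted _ (s≤s k<) =
  nth1-sorted≡0⇐ (suc k) (tail sorted) (s≤s z≤n) k<
nth1-sorted≡0⇐ {suc x ∷ xs} (suc k)       sorted _ k≤
  with () ← subst (suc k ≤_) (zeros-sorted-positive sorted) k≤

inI-0 : ∀ b → inI b 0 ≡ false
inI-0 b rewrite ∨-zeroʳ (bit b 0) = refl

inI-∧-bit : ∀ b u → (inI b u ∧ bit b u) ≡ false
inI-∧-bit b u with bit b u
... | true  = refl
... | false = ∧-zeroʳ _

degB≡0 : ∀ b v → (∀ u → 0 < u → u < v → bit b u ≡ true) → degB b v ≡ 0
degB≡0 b v earlierInJ = countB-none _ (vertices b) noINeighbour
  where
  noINeighbour : ∀ u → (inI b u ∧ adj b u v) ≡ false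
  noINeighbour u with u <ᵇ v in u<ᵇv
  noINeighbour zero    | true = cong (_∧ bit b v) (inI-0 b)
  noINeighbour (suc u) | true rewrite earlierInJ (suc u) (s≤s z≤n) (<ᵇ⇒< (suc u) v (subst T (sym u<ᵇv) _)) = refl
  noINeighbour u       | false with v <ᵇ u
  ... | true  = inI-∧-bit b u
  ... | false = ∧-zeroʳ _

degB-positive : ∀ b {u v} → bit b v ≡ true → 0 < u → u < v → v < length b → bit b u ≡ false →
  0 < degB b v
degB-positive b {suc u} {v} bv _ u<v v<n bu = countB-∈ _ (∈-upTo⁺ (<-trans u<v v<n)) iNeighbour
  where
  iNeighbour : (inI b (suc u) ∧ adj b (suc u) v) ≡ true
  iNeighbour rewrite bu | <ᵇ-true u<v = bv

leadingTrues : List Bool → ℕ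
leadingTrues (true ∷ cs) = suc (leadingTrues cs)
leadingTrues _           = 0

leadingTrues≤length : ∀ cs → leadingTrues cs ≤ length cs
leadingTrues≤length []          = z≤n
leadingTrues≤length (true ∷ cs)  = s≤s (leadingTrues≤length cs)
leadingTrues≤length (false ∷ cs) = z≤n

bit-<leadingTrues : ∀ cs {u} → u < leadingTrues cs → bit cs u ≡ true
bit-<leadingTrues (true ∷ cs) {zero}  _          = refl
bit-<leadingTrues (true ∷ cs) {suc u} (s≤s u<ℓ) = bit-<leadingTrues cs u<ℓ

bit-leadingTrues : ∀ cs → leadingTrues cs < length cs → bit cs (leadingTrues cs) ≡ false
bit-leadingTrues (true ∷ cs)  (s≤s ℓ<n) = bit-leadingTrues cs ℓ<n
bit-leadingTrues (false ∷ cs) _         = refl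

leadingTrues-++ : ∀ n cs → leadingTrues (replicate n true ++ cs) ≡ n + leadingTrues cs
leadingTrues-++ zero    cs = refl
leadingTrues-++ (suc n) cs = cong suc (leadingTrues-++ n cs)

leadingTrues-blockSeq : ∀ ps → All (λ p → 1 ≤ proj₁ p × 1 ≤ proj₂ p) ps → leadingTrues (blockSeq ps) ≡ 0
leadingTrues-blockSeq []                 _                        = refl
leadingTrues-blockSeq ((suc t , s) ∷ ps) _                        = refl
leadingTrues-blockSeq ((zero , s) ∷ ps)  ((() , _) ∷ _)

hasDegree0InB : List Bool → ℕ → Bool
hasDegree0InB b v = inJ b v ∧ (degB b v ≡ᵇ 0)

hasDegree0InB-true : ∀ b v → inJ b v ≡ true → degB b v ≡ 0 → hasDegree0InB b v ≡ true
hasDegree0InB-true b v v∈J deg≡0 = cong₂ _∧_ v∈J (cong (_≡ᵇ 0) deg≡0)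

hasDegree0InB-∉J : ∀ b v → inJ b v ≡ false → hasDegree0InB b v ≡ false
hasDegree0InB-∉J b v v∉J = cong (_∧ (degB b v ≡ᵇ 0)) v∉J

hasDegree0InB-positive : ∀ b v → 0 < degB b v → hasDegree0InB b v ≡ false
hasDegree0InB-positive b v deg>0 = trans (cong (inJ b v ∧_) (≡ᵇ0-false deg>0)) (∧-zeroʳ _)

hasDegree0InB-∷ : ∀ c cs v → v < suc (length cs) →
  hasDegree0InB (c ∷ cs) v ≡ (v <ᵇ suc (leadingTrues cs))
hasDegree0InB-∷ c cs zero _ =
  hasDegree0InB-true (c ∷ cs) 0 (∨-zeroʳ c) (degB≡0 (c ∷ cs) 0 (λ _ _ ()))
hasDegree0InB-∷ c cs (suc w) (s≤s w<n) with w <? leadingTrues cs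
... | yes w<ℓ = trans (hasDegree0InB-true (c ∷ cs) (suc w) w∈J deg≡0) (sym (<ᵇ-true w<ℓ))
  where
  w∈J : inJ (c ∷ cs) (suc w) ≡ true
  w∈J = trans (∨-identityʳ _) (bit-<leadingTrues cs w<ℓ)
  deg≡0 : degB (c ∷ cs) (suc w) ≡ 0
  deg≡0 = degB≡0 (c ∷ cs) (suc w) λ { (suc u) _ (s≤s u<w) → bit-<leadingTrues cs (<-trans u<w w<ℓ) }
... | no w≮ℓ = trans (notDegree0 (bit cs w) refl) (sym (<ᵇ-false (≮⇒≥ w≮ℓ)))
  where
  bℓ : bit cs (leadingTrues cs) ≡ false
  bℓ = bit-leadingTrues cs (≤-<-trans (≮⇒≥ w≮ℓ) w<n)
  notDegree0 : ∀ β → bit cs w ≡ β → hasDegree0InB (c ∷ cs) (suc w) ≡ false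
  notDegree0 false bw = hasDegree0InB-∉J (c ∷ cs) (suc w) (trans (∨-identityʳ _) bw)
  notDegree0 true  bw = hasDegree0InB-positive (c ∷ cs) (suc w)
                          (degB-positive (c ∷ cs) bw (s≤s z≤n) (s≤s ℓ<w) (s≤s w<n) bℓ)
    where
    ℓ≢w : leadingTrues cs ≢ w
    ℓ≢w ℓ≡w with () ← trans (sym bw) (subst (λ i → bit cs i ≡ false) ℓ≡w bℓ)
    ℓ<w : leadingTrues cs < w
    ℓ<w = ≤∧≢⇒< (≮⇒≥ w≮ℓ) ℓ≢w

zeroDegreeCount : List Bool → ℕ
zeroDegreeCount b = zeros (map (degB b) (Jverts b))

zeroDegreeCount-∷ : ∀ c cs → zeroDegreeCount (c ∷ cs) ≡ suc (leadingTrues cs)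
zeroDegreeCount-∷ c cs = begin
  zeroDegreeCount b                                ≡⟨ countB-map-filterB _ (degB b) (inJ b) (vertices b) ⟩
  countB (hasDegree0InB b) (upTo (suc (length cs))) ≡⟨ countB-upTo-initialSegment _ _ _ (hasDegree0InB-∷ c cs) ⟩
  suc (length cs) ⊓ suc (leadingTrues cs)          ≡⟨ m≥n⇒m⊓n≡n (s≤s (leadingTrues≤length cs)) ⟩
  suc (leadingTrues cs)                            ∎
  where
  open ≡-Reasoning
  b : List Bool
  b = c ∷ cs

e≡just0⇔≤zeroDegreeCount : ∀ b {z} → zeroDegreeCount b ≡ z → ∀ k → (e b k ≡ just 0) ⇔ (1 ≤ k × k ≤ z)
e≡just0⇔≤zeroDegreeCount b {z} count≡z k = mk⇔
  (λ eq → subst (λ z → 1 ≤ k × k ≤ z) zeros-sorted (nth1-sorted≡0⇒ k (sort-↗ degrees) eq))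
  (λ (1≤k , k≤z) → nth1-sorted≡0⇐ k (sort-↗ degrees) 1≤k (subst (k ≤_) (sym zeros-sorted) k≤z))
  where
  degrees : List ℕ
  degrees = map (degB b) (Jverts b)
  zeros-sorted : zeros (sort degrees) ≡ z
  zeros-sorted = trans (countB-↭ _ (sort-↭ degrees)) count≡z

zeroDegreeCount-t₁≡1 : ∀ s₁ rest → All (λ p → 1 ≤ proj₁ p × 1 ≤ proj₂ p) rest →
  zeroDegreeCount (blockSeq ((1 , s₁) ∷ rest)) ≡ s₁ + 1
zeroDegreeCount-t₁≡1 s₁ rest hr = begin
  zeroDegreeCount (false ∷ replicate s₁ true ++ blockSeq rest) ≡⟨ zeroDegreeCount-∷ false _ ⟩
  suc (leadingTrues (replicate s₁ true ++ blockSeq rest))   ≡⟨ cong suc (leadingTrues-++ s₁ (blockSeq rest)) ⟩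
  suc (s₁ + leadingTrues (blockSeq rest))                  ≡⟨ cong (λ n → suc (s₁ + n)) (leadingTrues-blockSeq rest hr) ⟩
  suc (s₁ + 0)                                             ≡⟨ cong suc (+-identityʳ s₁) ⟩
  suc s₁                                                   ≡⟨ +-comm 1 s₁ ⟩
  s₁ + 1                                                   ∎
  where open ≡-Reasoning

zeroDegreeCount-t₁≥2 : ∀ t s₁ rest → zeroDegreeCount (blockSeq ((suc (suc t) , s₁) ∷ rest)) ≡ 1
zeroDegreeCount-t₁≥2 t s₁ rest =
  zeroDegreeCount-∷ false ((replicate (suc t) false ++ replicate s₁ true) ++ blockSeq rest)

lemma3p1 : (t₁ s₁ : ℕ) (rest : List (ℕ × ℕ))
  → 1 ≤ t₁ → 1 ≤ s₁
  → All (λ p → 1 ≤ proj₁ p × 1 ≤ proj₂ p) rest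
  → let blocks = (t₁ , s₁) ∷ rest
        b = blockSeq blocks
        r = sumT blocks ∸ 1
        s = sumS blocks + 1
    in r < s
  → (e b (s ∸ r) ≡ just 0)
    ⇔ ((t₁ ≢ 1 × s ∸ r ≡ 1) ⊎ (t₁ ≡ 1 × 1 ≤ s ∸ r × s ∸ r ≤ s₁ + 1))
lemma3p1 zero _ _ () _ _ _
lemma3p1 (suc zero) s₁ rest _ _ hr r<s = mk⇔
  (λ eq → inj₂ (refl , Equivalence.to (zero⇔ _) eq))
  (λ { (inj₁ (t₁≢1 , _)) → ⊥-elim (t₁≢1 refl)
     ; (inj₂ (_ , bounds)) → Equivalence.from (zero⇔ _) bounds })
  where
  zero⇔ : ∀ k → (e (blockSeq ((1 , s₁) ∷ rest)) k ≡ just 0) ⇔ (1 ≤ k × k ≤ s₁ + 1)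
  zero⇔ = e≡just0⇔≤zeroDegreeCount (blockSeq ((1 , s₁) ∷ rest)) (zeroDegreeCount-t₁≡1 s₁ rest hr)
lemma3p1 (suc (suc t)) s₁ rest _ _ _ r<s = mk⇔
  (λ eq → inj₁ ((λ ()) , ≤-antisym (proj₂ (Equivalence.to (zero⇔ _) eq)) (m<n⇒0<n∸m r<s)))
  (λ { (inj₁ (_ , s∸r≡1)) → Equivalence.from (zero⇔ _) (m<n⇒0<n∸m r<s , ≤-reflexive s∸r≡1)
     ; (inj₂ (() , _)) })
  where
  zero⇔ : ∀ k → (e (blockSeq ((suc (suc t) , s₁) ∷ rest)) k ≡ just 0) ⇔ (1 ≤ k × k ≤ 1)
  zero⇔ = e≡just0⇔≤zeroDegreeCount (blockSeq ((suc (suc t) , s₁) ∷ rest)) (zeroDegreeCount-t₁≥2 t s₁ rest)
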